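{- Let $k=\mathbb{F}_q$, $q=2^n$, fix $c_0\in k$ with $\operatorname{Tr}(c_0)=1$, and let $E\colon y^2+y=ax^3+bx^2+c$ with $a\in k^*$, $b\in k$, $c\in\{0,c_0\}$. (1) Suppose $q$ is a square. If $a$ is not a cube in $k^*$, or $a=u^3$ with $u\in k^*$ and $bu^{ -2}\in\operatorname{AS}^2(k)$, then there exists $v\in k$ with $va+v^4a^2=b$, and for any such $v$, $E$ is $k$-isomorphic to $E_a$ if $\operatorname{Tr}(c+v^3a)=0$ and to $E_a'$ if $\operatorname{Tr}(c+v^3a)=1$. If $a=u^3$ with $bu^{ -2}\notin\operatorname{AS}^2(k)$, then $E$ is $k$-isomorphic to $E_0$. (2) Suppose $q$ is not a square and write $a=u^3$ with $u\in k^*$. If $bu^{ -2}\in\operatorname{AS}(k)$, then $E$ is $k$-isomorphic to $E_1$. If $bu^{ -2}\notin\operatorname{AS}(k)$, then there exists $v\in k$ with $1+v+v^4=bu^{ -2}$, and for any such $v$, $E$ is $k$-isomorphic to $H$ if $\operatorname{Tr}(c+v^3+v)=0$ and to $H'$ if $\operatorname{Tr}(c+v^3+v)=1$.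
   Context: $\operatorname{Tr}$ denotes the absolute trace $\operatorname{Tr}_{k/\mathbb{F}_2}$; $\operatorname{AS}(x)=x+x^2$ and $\operatorname{AS}^2(x)=x+x^4$ as maps $k\to k$. Models: $E_a\colon y^2+y=ax^3$ ($a\in k^*$), $E_1$ is $E_a$ with $a=1$, $H\colon y^2+y=x^3+x^2$, $E_0\colon y^2+y=c_0^{ -3}x^3+x^2$; for $E\colon y^2+y=ax^3+bx^2+c$, $E'$ denotes $y^2+y=ax^3+bx^2+c+c_0$. -}

module Defs where

open import Level using (0ℓ)
open import Data.Nat using (ℕ; zero; suc; _^_) renaming (_*_ to _*ℕ_)
open import Data.List using (List; length)
open import Data.List.Relation.Unary.Any using (Any)
open import Data.List.Relation.Unary.AllPairs using (AllPairs)
open import Data.Product using (Σ; ∃; _×_)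
open import Relation.Nullary using (¬_)
open import Relation.Binary.PropositionalEquality using (_≡_)
open import Algebra.Bundles using (CommutativeRing)

IsSquareℕ : ℕ → Set
IsSquareℕ q = ∃ λ m → m *ℕ m ≡ q

-- A finite field with exactly 2^n elements (hence k ≅ 𝔽_{2^n}, characteristic 2).
-- The inverse is a total function (value at 0 unconstrained), as in Lean/Mathlib.
record FiniteField2 (n : ℕ) : Set₁ where
  field
    commRing : CommutativeRing 0ℓ 0ℓ
  open CommutativeRing commRing
  field
    nontrivial : ¬ (1# ≈ 0#)
    inv        : Carrier → Carrier
    inv-cong   : ∀ {x y} → x ≈ y → inv x ≈ inv y
    inv-law    : ∀ x → ¬ (x ≈ 0#) → x * inv x ≈ 1#
    char2      : 1# + 1# ≈ 0#
    elems      : List Carrier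
    elems-len  : length elems ≡ 2 ^ n
    complete   : ∀ x → Any (x ≈_) elems
    distinct   : AllPairs (λ x y → ¬ (x ≈ y)) elems

module FieldDefs {n : ℕ} (F : FiniteField2 n) where
  open FiniteField2 F public
  open CommutativeRing commRing public

  sq : Carrier → Carrier
  sq x = x * x

  cube : Carrier → Carrier
  cube x = x * x * x

  pow4 : Carrier → Carrier
  pow4 x = sq (sq x)

  pow6 : Carrier → Carrier
  pow6 x = cube x * cube x

  trace-go : ℕ → Carrier → Carrier
  trace-go zero    x = 0#
  trace-go (suc m) x = x + trace-go m (sq x)

  Tr : Carrier → Carrier
  Tr x = trace-go n x

  AS : Carrier → Carrier
  AS x = x + sq x

  AS² : Carrier → Carrier
  AS² x = x + pow4 x

  InAS : Carrier → Set
  InAS z = ∃ λ w → AS w ≈ z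

  InAS² : Carrier → Set
  InAS² z = ∃ λ w → AS² w ≈ z

  IsNonzeroCube : Carrier → Set
  IsNonzeroCube a = ∃ λ u → ¬ (u ≈ 0#) × cube u ≈ a

  -- general Weierstrass equation
  -- y^2 + a1 x y + a3 y = x^3 + a2 x^2 + a4 x + a6
  record Weierstrass : Set where
    constructor W
    field
      a1 a2 a3 a4 a6 : Carrier

  -- k-isomorphism of Weierstrass equations: there is an admissible change of
  -- variables x = u^2 x' + r, y = u^3 y' + s u^2 x' + t (u ∈ k*, r s t ∈ k)
  -- taking E to E' (Silverman, AEC III.1, Table 3.1).
  _≅_ : Weierstrass → Weierstrass → Set
  E ≅ E' = ∃ λ u → ∃ λ r → ∃ λ s → ∃ λ t →
      ¬ (u ≈ 0#)
    × (u * a1' ≈ a1 + (s + s))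
    × (sq u * a2' ≈ a2 + - (s * a1) + (r + r + r) + - sq s)
    × (cube u * a3' ≈ a3 + r * a1 + (t + t))
    × (pow4 u * a4' ≈ a4 + - (s * a3) + (r + r) * a2 + - ((t + r * s) * a1)
                       + (sq r + sq r + sq r) + - ((s + s) * t))
    × (pow6 u * a6' ≈ a6 + r * a4 + sq r * a2 + cube r + - (t * a3) + - sq t
                       + - (r * t * a1))
    where
      open Weierstrass E
      open Weierstrass E' renaming (a1 to a1'; a2 to a2'; a3 to a3'; a4 to a4'; a6 to a6')

  -- The curve  y^2 + y = a x^3 + b x^2 + c  (a ≠ 0).  Via the k-isomorphism
  -- (x , y) ↦ (X , Y) = (a x , a y) it is the Weierstrass equation
  -- Y^2 + a Y = X^3 + b X^2 + c a^2.
  Curve : Carrier → Carrier → Carrier → Weierstrass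
  Curve a b c = W 0# b a 0# (c * sq a)

  E[_] : Carrier → Weierstrass
  E[ a ] = Curve a 0# 0#

  E[_]′ : Carrier → Carrier → Weierstrass
  E[ a ]′ c0 = Curve a 0# c0

  E₁ : Weierstrass
  E₁ = Curve 1# 0# 0#

  H : Weierstrass
  H = Curve 1# 1# 0#

  H′ : Carrier → Weierstrass
  H′ c0 = Curve 1# 1# c0

  E₀ : Carrier → Weierstrass
  E₀ c0 = Curve (cube (inv c0)) 1# 0#

-- Each isomorphism is an explicit admissible change of variables; the work is to solve for its
-- parameters. After scaling by a cube root u of a, these reduce to the additive equations
-- τ + τ² = x and ρ + ρ⁴ = x. Additive Hilbert 90 decides when they can be solved: for a
-- σ-periodic ring map σ and an element of σ-trace 1 (here c₀), the elements of σ-trace 0 are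
-- exactly the w + σ w. The relevant trace is Tr for τ. For ρ it is the trace Tr₄ to 𝔽₄ when n is
-- even, and Tr itself when n is odd (then Tr 1 = 1). The Frobenius is periodic by Fermat's little
-- theorem, proved by counting the list of elements. The same counting shows that the injective
-- map v ↦ v a + v⁴ a² (for a not a cube) is surjective. Finally, moving ρ by a suitable element
-- of 𝔽₄ changes the trace of the constant term by 1, so that trace can always be made 0.

module Submission where

open import Defs
open import Algebra.Bundles using (RawRing; CommutativeRing)
import Algebra.Solver.Ring.AlmostCommutativeRing as ACR
open import Data.Bool using (Bool; true; false; _xor_; _∧_)
open import Data.Maybe using (Maybe; just; nothing)
open import Data.Nat using (ℕ; zero; suc; _^_; _≤_) renaming (_+_ to _+ℕ_)
import Data.Nat.Properties as ℕ
open import Data.Nat.GeneralisedArithmetic using (iterate)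
open import Data.List using (List; []; _∷_; _++_; length; map; foldr)
open import Data.List.Properties using (length-++; ++-identityʳ; length-map)
open import Data.List.Relation.Unary.Any using (here; there)
open import Data.List.Relation.Unary.All.Properties using (All¬⇒¬Any)
open import Data.List.Relation.Unary.AllPairs using (_∷_; head; tail)
open import Data.Product using (∃; _×_; _,_; proj₁; proj₂)
open import Data.Sum using (_⊎_; inj₁; inj₂; [_,_]′)
open import Data.Empty using (⊥; ⊥-elim)
open import Function.Definitions using (Injective)
open import Relation.Nullary using (¬_; Dec; yes; no)
open import Relation.Binary.Bundles using (Setoid)
open import Relation.Binary.Definitions using (Decidable)
open import Relation.Binary.PropositionalEquality using (_≡_; _≢_)
import Relation.Binary.PropositionalEquality as ≡

module _ where
  open import Data.Nat using (_+_; _*_)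
  open import Data.Nat.Divisibility using (_∣_; divides)
  open import Data.Nat.Primality using (euclidsLemma; prime[2])
  open import Data.Nat.Tactic.RingSolver using (solve-∀)
  open ≡ using (refl; trans; sym; cong)
  open import Data.Nat.Properties using (+-suc; *-comm; *-cancelˡ-≡; even≢odd; ^-distribˡ-+-*)

  parity : ∀ n → (∃ λ m → n ≡ m + m) ⊎ (∃ λ m → n ≡ suc (m + m))
  parity zero = inj₁ (0 , refl)
  parity (suc n) with parity n
  ... | inj₁ (m , refl) = inj₂ (m , refl)
  ... | inj₂ (m , refl) = inj₁ (suc m , cong suc (sym (+-suc m m)))

  square-of-double : ∀ j → j * 2 * (j * 2) ≡ 2 * (2 * (j * j))
  square-of-double = solve-∀

  -- Descent: a square root of 2^(2h+1) is even, and halving it gives a square root of 2^(2h-1).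
  2^odd-nonSquare : ∀ h k → k * k ≢ 2 ^ suc (h + h)
  twice-square≢2^even : ∀ h j → 2 * (j * j) ≢ 2 ^ (h + h)

  2^odd-nonSquare h k eq = [ halve , halve ]′ (euclidsLemma k k prime[2] (divides (2 ^ (h + h)) (trans eq (*-comm 2 (2 ^ (h + h))))))
    where
    halve : 2 ∣ k → ⊥
    halve (divides j refl) = twice-square≢2^even h j (*-cancelˡ-≡ _ _ 2 (trans (sym (square-of-double j)) eq))

  twice-square≢2^even zero    j eq = even≢odd (j * j) 0 eq
  twice-square≢2^even (suc h) j eq = 2^odd-nonSquare h j (*-cancelˡ-≡ _ _ 2 (trans eq (cong (2 ^_) (+-suc (suc h) h))))

  square⇒even-exponent : ∀ {n} → IsSquareℕ (2 ^ n) → ∃ λ m → n ≡ m + m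
  square⇒even-exponent {n} (k , k*k≡2^n) with parity n
  ... | inj₁ even       = even
  ... | inj₂ (h , refl) = ⊥-elim (2^odd-nonSquare h k k*k≡2^n)

  nonSquare⇒odd-exponent : ∀ {n} → ¬ IsSquareℕ (2 ^ n) → ∃ λ h → n ≡ suc (h + h)
  nonSquare⇒odd-exponent {n} ¬square with parity n
  ... | inj₁ (m , refl) = ⊥-elim (¬square (2 ^ m , sym (^-distribˡ-+-* 2 m m)))
  ... | inj₂ odd        = odd

module FiniteSetoid {c ℓ} (S : Setoid c ℓ) where
  open Setoid S renaming (Carrier to A)
  open import Data.List.Membership.Setoid S using (_∈_)
  open import Data.List.Membership.Setoid.Properties using (∈-∃++; ∈-resp-≈; ∈-map⁻)
  open import Data.List.Relation.Binary.Subset.Setoid S using (_⊆_)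
  open import Data.List.Relation.Unary.Unique.Setoid S using (Unique)
  open import Data.List.Relation.Unary.Unique.Setoid.Properties using () renaming (map⁺ to Unique-map⁺)
  open import Data.List.Relation.Binary.Permutation.Setoid S using (_↭_; ↭-refl; ↭-trans; ↭-prep; ↭-reflexive-≋)
  open import Data.List.Relation.Binary.Permutation.Setoid.Properties S using (shift; ∈-resp-↭; xs↭ys⇒|xs|≡|ys|)

  ∈⇒↭∷ : ∀ {x xs} → x ∈ xs → ∃ λ rest → xs ↭ x ∷ rest
  ∈⇒↭∷ x∈xs with ∈-∃++ S x∈xs
  ... | as , bs , _ , x≈w , xs≋ = as ++ bs , ↭-trans (↭-reflexive-≋ xs≋) (shift (sym x≈w) as bs)

  ⊆-unique⇒↭++ : ∀ {xs ys} → Unique ys → ys ⊆ xs → ∃ λ zs → xs ↭ ys ++ zs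
  ⊆-unique⇒↭++ {xs} {[]}     _              _     = xs , ↭-refl
  ⊆-unique⇒↭++ {xs} {y ∷ ys} (y≉ys ∷ ys!) ys⊆xs with ∈⇒↭∷ (ys⊆xs (here refl))
  ... | rest , xs↭y∷rest =
    let zs , rest↭ys++zs = ⊆-unique⇒↭++ ys! ys⊆rest in zs , ↭-trans xs↭y∷rest (↭-prep y rest↭ys++zs)
    where
    ys⊆rest : ys ⊆ rest
    ys⊆rest {x} x∈ys with ∈-resp-↭ xs↭y∷rest (ys⊆xs (there x∈ys))
    ... | here x≈y = ⊥-elim (All¬⇒¬Any y≉ys (∈-resp-≈ S x≈y x∈ys))
    ... | there x∈rest = x∈rest

  ⊆-unique-length⇒↭ : ∀ {xs ys} → Unique ys → ys ⊆ xs → length xs ≤ length ys → xs ↭ ys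
  ⊆-unique-length⇒↭ {xs} {ys} ys! ys⊆xs |xs|≤|ys| with ⊆-unique⇒↭++ ys! ys⊆xs
  ... | []     , xs↭ys++[] = ≡.subst (xs ↭_) (++-identityʳ ys) xs↭ys++[]
  ... | z ∷ zs , xs↭ys++zs =
    ⊥-elim (ℕ.m+1+n≰m (length ys) (≡.subst (_≤ length ys) (≡.trans (xs↭ys⇒|xs|≡|ys| xs↭ys++zs) (length-++ ys)) |xs|≤|ys|))

  enumeration⇒decidable : ∀ {xs} → Unique xs → (∀ x → x ∈ xs) → Decidable _≈_
  enumeration⇒decidable xs! complete x y = decide xs! (complete x) (complete y)
    where
    decide : ∀ {xs x y} → Unique xs → x ∈ xs → y ∈ xs → Dec (x ≈ y)
    decide _            (here x≈z)   (here y≈z)   = yes (trans x≈z (sym y≈z))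
    decide (z≉zs ∷ _)   (here x≈z)   (there y∈zs) = no λ x≈y → All¬⇒¬Any z≉zs (∈-resp-≈ S (trans (sym x≈y) x≈z) y∈zs)
    decide (z≉zs ∷ _)   (there x∈zs) (here y≈z)   = no λ x≈y → All¬⇒¬Any z≉zs (∈-resp-≈ S (trans x≈y y≈z) x∈zs)
    decide (_ ∷ zs!)    (there x∈zs) (there y∈zs) = decide zs! x∈zs y∈zs

  injective⇒surjective : ∀ {xs} → Unique xs → (∀ x → x ∈ xs) →
                         ∀ {f : A → A} → Injective _≈_ _≈_ f → ∀ y → ∃ λ x → f x ≈ y
  injective⇒surjective {xs} xs! complete {f} f-inj y =
    let x , _ , y≈fx = ∈-map⁻ S S (∈-resp-↭ xs↭fxs (complete y)) in x , sym y≈fx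
    where
    xs↭fxs : xs ↭ map f xs
    xs↭fxs = ⊆-unique-length⇒↭ (Unique-map⁺ S S f-inj xs!) (λ {v} _ → complete v) (ℕ.≤-reflexive (≡.sym (length-map f xs)))

-- Coefficients are reduced modulo 2, so the solver proves identities of commutative rings of
-- characteristic 2 such as (x + y)² = x² + y².
𝔽₂ : RawRing _ _
𝔽₂ = record { Carrier = Bool ; _≈_ = _≡_ ; _+_ = _xor_ ; _*_ = _∧_ ; -_ = λ x → x ; 0# = false ; 1# = true }

Characteristic2 : ∀ {c ℓ} → CommutativeRing c ℓ → Set ℓ
Characteristic2 R = 1# + 1# ≈ 0#
  where open CommutativeRing R

module Char2RingSolver {c ℓ} (R : CommutativeRing c ℓ) (char2 : Characteristic2 R) where
  open CommutativeRing R
  open import Algebra.Properties.Ring ring using (-0#≈0#)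
  open import Relation.Binary.Reasoning.Setoid setoid

  private
    ⟦_⟧ : Bool → Carrier
    ⟦ true  ⟧ = 1#
    ⟦ false ⟧ = 0#

    -1≈1 : - 1# ≈ 1#
    -1≈1 = begin
      - 1#             ≈⟨ +-identityʳ (- 1#) ⟨
      - 1# + 0#        ≈⟨ +-congˡ char2 ⟨
      - 1# + (1# + 1#) ≈⟨ +-assoc (- 1#) 1# 1# ⟨
      (- 1# + 1#) + 1# ≈⟨ +-congʳ (-‿inverseˡ 1#) ⟩
      0# + 1#          ≈⟨ +-identityˡ 1# ⟩
      1#               ∎

    +-homo : ∀ x y → ⟦ x xor y ⟧ ≈ ⟦ x ⟧ + ⟦ y ⟧
    +-homo true  true  = sym char2
    +-homo true  false = sym (+-identityʳ 1#)
    +-homo false y     = sym (+-identityˡ ⟦ y ⟧)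

    *-homo : ∀ x y → ⟦ x ∧ y ⟧ ≈ ⟦ x ⟧ * ⟦ y ⟧
    *-homo true  y = sym (*-identityˡ ⟦ y ⟧)
    *-homo false y = sym (zeroˡ ⟦ y ⟧)

    -‿homo : ∀ x → ⟦ x ⟧ ≈ - ⟦ x ⟧
    -‿homo true  = sym -1≈1
    -‿homo false = sym -0#≈0#

    morphism : 𝔽₂ ACR.-Raw-AlmostCommutative⟶ ACR.fromCommutativeRing R
    morphism = record { ⟦_⟧ = ⟦_⟧ ; +-homo = +-homo ; *-homo = *-homo ; -‿homo = -‿homo ; 0-homo = refl ; 1-homo = refl }

    _≟₂_ : ∀ x y → Maybe (⟦ x ⟧ ≈ ⟦ y ⟧)
    true  ≟₂ true  = just refl
    false ≟₂ false = just refl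
    _     ≟₂ _     = nothing

  open import Algebra.Solver.Ring 𝔽₂ (ACR.fromCommutativeRing R) morphism _≟₂_ public
    using (solve; _:=_; _:+_; _:*_; :-_; con)

  x+x≈0 : ∀ x → x + x ≈ 0#
  x+x≈0 = solve 1 (λ x → x :+ x := con false) refl

iterate-shift : ∀ {a} {A : Set a} (f : A → A) x k → iterate f (f x) k ≡ f (iterate f x k)
iterate-shift f x zero    = ≡.refl
iterate-shift f x (suc k) = iterate-shift f (f x) k

iterate-∘-twice : ∀ {a} {A : Set a} (f : A → A) x m → iterate (λ y → f (f y)) x m ≡ iterate f x (m +ℕ m)
iterate-∘-twice f x zero    = ≡.refl
iterate-∘-twice f x (suc m) =
  ≡.trans (iterate-∘-twice f (f (f x)) m) (≡.cong (iterate f (f x)) (≡.sym (ℕ.+-suc m m)))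

module FiniteFieldTheory {n : ℕ} (F : FiniteField2 n) where
  open FieldDefs F
  open Char2RingSolver commRing char2
  open FiniteSetoid setoid
  open import Relation.Binary.Reasoning.Setoid setoid
  open import Algebra.Properties.Semiring.Exp semiring using (^-homo-*) renaming (_^_ to _^ᶠ_)
  open import Data.List.Membership.Setoid setoid using (_∈_)
  open import Data.List.Membership.Setoid.Properties using (∈-resp-≈; ∈-map⁻)
  open import Data.List.Relation.Unary.Unique.Setoid setoid using (Unique)
  open import Data.List.Relation.Unary.Unique.Setoid.Properties using () renaming (map⁺ to Unique-map⁺)
  open import Data.List.Relation.Binary.Permutation.Setoid setoid using (_↭_)
  open import Data.List.Relation.Binary.Permutation.Setoid.Properties setoid
    using (∈-resp-↭; Unique-resp-↭; xs↭ys⇒|xs|≡|ys|; foldr-commMonoid)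

  x+y≈0⇒x≈y : ∀ {x y} → x + y ≈ 0# → x ≈ y
  x+y≈0⇒x≈y {x} {y} x+y≈0 = begin
    x           ≈⟨ solve 2 (λ x y → x := (x :+ y) :+ y) refl x y ⟩
    (x + y) + y ≈⟨ +-congʳ x+y≈0 ⟩
    0# + y      ≈⟨ +-identityˡ y ⟩
    y           ∎

  x≈y⇒x+y≈0 : ∀ {x y} → x ≈ y → x + y ≈ 0#
  x≈y⇒x+y≈0 {x} {y} x≈y = trans (+-congʳ x≈y) (x+x≈0 y)

  additive⇒0↦0 : ∀ (φ : Carrier → Carrier) → (∀ {x y} → x ≈ y → φ x ≈ φ y) →
                 (∀ x y → φ (x + y) ≈ φ x + φ y) → φ 0# ≈ 0#
  additive⇒0↦0 φ φ-cong φ-+ = begin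
    φ 0#                  ≈⟨ solve 1 (λ z → z := (z :+ z) :+ z) refl (φ 0#) ⟩
    (φ 0# + φ 0#) + φ 0#  ≈⟨ +-congʳ (φ-+ 0# 0#) ⟨
    φ (0# + 0#) + φ 0#    ≈⟨ x≈y⇒x+y≈0 (φ-cong (+-identityʳ 0#)) ⟩
    0#                    ∎

  x*y≈0⇒y≈0 : ∀ {x y} → x ≉ 0# → x * y ≈ 0# → y ≈ 0#
  x*y≈0⇒y≈0 {x} {y} x≉0 xy≈0 = begin
    y                ≈⟨ *-identityˡ y ⟨
    1# * y           ≈⟨ *-congʳ (inv-law x x≉0) ⟨
    (x * inv x) * y  ≈⟨ solve 3 (λ x i y → (x :* i) :* y := i :* (x :* y)) refl x (inv x) y ⟩
    inv x * (x * y)  ≈⟨ *-congˡ xy≈0 ⟩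
    inv x * 0#       ≈⟨ zeroʳ (inv x) ⟩
    0#               ∎

  *-≉0 : ∀ {x y} → x ≉ 0# → y ≉ 0# → x * y ≉ 0#
  *-≉0 x≉0 y≉0 xy≈0 = y≉0 (x*y≈0⇒y≈0 x≉0 xy≈0)

  *-cancelˡ : ∀ {g x y} → g ≉ 0# → g * x ≈ g * y → x ≈ y
  *-cancelˡ {g} {x} {y} g≉0 gx≈gy =
    x+y≈0⇒x≈y (x*y≈0⇒y≈0 g≉0 (trans (distribˡ g x y) (x≈y⇒x+y≈0 gx≈gy)))

  inv-≉0 : ∀ {x} → x ≉ 0# → inv x ≉ 0#
  inv-≉0 {x} x≉0 x⁻¹≈0 = nontrivial (begin
    1#         ≈⟨ inv-law x x≉0 ⟨
    x * inv x  ≈⟨ *-congˡ x⁻¹≈0 ⟩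
    x * 0#     ≈⟨ zeroʳ x ⟩
    0#         ∎)

  _≟_ : Decidable _≈_
  _≟_ = enumeration⇒decidable distinct complete

  sq≈id⇒0∨1 : ∀ {x} → sq x ≈ x → x ≈ 0# ⊎ x ≈ 1#
  sq≈id⇒0∨1 {x} x²≈x with x ≟ 0#
  ... | yes x≈0 = inj₁ x≈0
  ... | no  x≉0 = inj₂ (x+y≈0⇒x≈y (x*y≈0⇒y≈0 x≉0 (begin
    x * (x + 1#)  ≈⟨ solve 1 (λ x → x :* (x :+ con true) := x :* x :+ x) refl x ⟩
    sq x + x      ≈⟨ x≈y⇒x+y≈0 x²≈x ⟩
    0#            ∎)))

  sq-cong : ∀ {x y} → x ≈ y → sq x ≈ sq y
  sq-cong x≈y = *-cong x≈y x≈y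

  sq-+ : ∀ x y → sq (x + y) ≈ sq x + sq y
  sq-+ = solve 2 (λ x y → (x :+ y) :* (x :+ y) := x :* x :+ y :* y) refl

  sq-* : ∀ x y → sq (x * y) ≈ sq x * sq y
  sq-* = solve 2 (λ x y → (x :* y) :* (x :* y) := (x :* x) :* (y :* y)) refl

  pow4-cong : ∀ {x y} → x ≈ y → pow4 x ≈ pow4 y
  pow4-cong x≈y = sq-cong (sq-cong x≈y)

  pow4-+ : ∀ x y → pow4 (x + y) ≈ pow4 x + pow4 y
  pow4-+ x y = trans (sq-cong (sq-+ x y)) (sq-+ (sq x) (sq y))

  pow4-* : ∀ x y → pow4 (x * y) ≈ pow4 x * pow4 y
  pow4-* x y = trans (sq-cong (sq-* x y)) (sq-* (sq x) (sq y))

  prod : List Carrier → Carrier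
  prod = foldr _*_ 1#

  prod-map-* : ∀ g xs → prod (map (g *_) xs) ≈ g ^ᶠ length xs * prod xs
  prod-map-* g []       = sym (*-identityˡ 1#)
  prod-map-* g (x ∷ xs) = begin
    g * x * prod (map (g *_) xs)        ≈⟨ *-congˡ (prod-map-* g xs) ⟩
    g * x * (g ^ᶠ length xs * prod xs)  ≈⟨ solve 4 (λ g x p r → g :* x :* (p :* r) := g :* p :* (x :* r))
                                                   refl g x (g ^ᶠ length xs) (prod xs) ⟩
    g * g ^ᶠ length xs * (x * prod xs)  ∎

  prod-≉0 : ∀ {xs} → (∀ {x} → x ∈ xs → x ≉ 0#) → prod xs ≉ 0#
  prod-≉0 {[]}     _     = nontrivial
  prod-≉0 {x ∷ xs} xs≉0 = *-≉0 (xs≉0 (here refl)) (prod-≉0 (λ x∈xs → xs≉0 (there x∈xs)))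

  nonzeros : List Carrier
  nonzeros = proj₁ (∈⇒↭∷ (complete 0#))

  elems↭0∷nonzeros : elems ↭ 0# ∷ nonzeros
  elems↭0∷nonzeros = proj₂ (∈⇒↭∷ (complete 0#))

  0∷nonzeros-unique : Unique (0# ∷ nonzeros)
  0∷nonzeros-unique = Unique-resp-↭ elems↭0∷nonzeros distinct

  ∈nonzeros⇒≉0 : ∀ {x} → x ∈ nonzeros → x ≉ 0#
  ∈nonzeros⇒≉0 x∈nonzeros x≈0 = All¬⇒¬Any (head 0∷nonzeros-unique) (∈-resp-≈ setoid x≈0 x∈nonzeros)

  ≉0⇒∈nonzeros : ∀ {x} → x ≉ 0# → x ∈ nonzeros
  ≉0⇒∈nonzeros {x} x≉0 with ∈-resp-↭ elems↭0∷nonzeros (complete x)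
  ... | here  x≈0         = ⊥-elim (x≉0 x≈0)
  ... | there x∈nonzeros = x∈nonzeros

  q≡1+|nonzeros| : 2 ^ n ≡ suc (length nonzeros)
  q≡1+|nonzeros| = ≡.trans (≡.sym elems-len) (xs↭ys⇒|xs|≡|ys| elems↭0∷nonzeros)

  -- Multiplication by x permutes the nonzero elements, so their product P satisfies P = x^(q-1) P.
  x^[q-1]≈1 : ∀ {x} → x ≉ 0# → x ^ᶠ length nonzeros ≈ 1#
  x^[q-1]≈1 {x} x≉0 = x+y≈0⇒x≈y (x*y≈0⇒y≈0 (prod-≉0 ∈nonzeros⇒≉0) (begin
    P * (x ^ᶠ L + 1#)  ≈⟨ solve 2 (λ P y → P :* (y :+ con true) := y :* P :+ P) refl P (x ^ᶠ L) ⟩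
    x ^ᶠ L * P + P     ≈⟨ x≈y⇒x+y≈0 (sym (trans P≈xP (prod-map-* x nonzeros))) ⟩
    0#                 ∎))
    where
    L = length nonzeros
    P = prod nonzeros
    x*nonzeros⊆nonzeros : ∀ {v} → v ∈ map (x *_) nonzeros → v ∈ nonzeros
    x*nonzeros⊆nonzeros v∈ = let w , w∈ , v≈xw = ∈-map⁻ setoid setoid v∈ in
      ≉0⇒∈nonzeros (λ v≈0 → *-≉0 x≉0 (∈nonzeros⇒≉0 w∈) (trans (sym v≈xw) v≈0))
    P≈xP : P ≈ prod (map (x *_) nonzeros)
    P≈xP = foldr-commMonoid *-isCommutativeMonoid
      (⊆-unique-length⇒↭ (Unique-map⁺ setoid setoid (*-cancelˡ x≉0) (tail 0∷nonzeros-unique))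
                          x*nonzeros⊆nonzeros (ℕ.≤-reflexive (≡.sym (length-map (x *_) nonzeros))))

  x*x^[q-1]≈x : ∀ x → x * x ^ᶠ length nonzeros ≈ x
  x*x^[q-1]≈x x with x ≟ 0#
  ... | yes x≈0 = trans (*-congʳ x≈0) (trans (zeroˡ _) (sym x≈0))
  ... | no  x≉0 = trans (*-congˡ (x^[q-1]≈1 x≉0)) (*-identityʳ x)

  x^q≈x : ∀ x → x ^ᶠ (2 ^ n) ≈ x
  x^q≈x x = begin
    x ^ᶠ (2 ^ n)                 ≡⟨ ≡.cong (x ^ᶠ_) q≡1+|nonzeros| ⟩
    x * x ^ᶠ length nonzeros     ≈⟨ x*x^[q-1]≈x x ⟩
    x                            ∎

  iterate-sq : ∀ k x → iterate sq x k ≈ x ^ᶠ (2 ^ k)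
  iterate-sq zero    x = sym (*-identityʳ x)
  iterate-sq (suc k) x = begin
    iterate sq x (suc k)             ≡⟨ iterate-shift sq x k ⟩
    sq (iterate sq x k)              ≈⟨ sq-cong (iterate-sq k x) ⟩
    x ^ᶠ (2 ^ k) * x ^ᶠ (2 ^ k)      ≈⟨ ^-homo-* x (2 ^ k) (2 ^ k) ⟨
    x ^ᶠ (2 ^ k +ℕ 2 ^ k)            ≡⟨ ≡.cong (λ e → x ^ᶠ (2 ^ k +ℕ e)) (≡.sym (ℕ.+-identityʳ (2 ^ k))) ⟩
    x ^ᶠ (2 ^ suc k)                 ∎

  frobenius-period : ∀ x → iterate sq x n ≈ x
  frobenius-period x = trans (iterate-sq n x) (x^q≈x x)

  module AdditiveTrace (σ : Carrier → Carrier) (σ-cong : ∀ {x y} → x ≈ y → σ x ≈ σ y)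
                       (σ-+ : ∀ x y → σ (x + y) ≈ σ x + σ y) (σ-* : ∀ x y → σ (x * y) ≈ σ x * σ y) where

    tr : ℕ → Carrier → Carrier
    tr zero    x = 0#
    tr (suc k) x = x + tr k (σ x)

    tr-cong : ∀ k {x y} → x ≈ y → tr k x ≈ tr k y
    tr-cong zero    _   = refl
    tr-cong (suc k) x≈y = +-cong x≈y (tr-cong k (σ-cong x≈y))

    tr-+ : ∀ k x y → tr k (x + y) ≈ tr k x + tr k y
    tr-+ zero    x y = sym (+-identityʳ 0#)
    tr-+ (suc k) x y = begin
      (x + y) + tr k (σ (x + y))                ≈⟨ +-congˡ (trans (tr-cong k (σ-+ x y)) (tr-+ k (σ x) (σ y))) ⟩
      (x + y) + (tr k (σ x) + tr k (σ y))       ≈⟨ solve 4 (λ x y a b → (x :+ y) :+ (a :+ b) := (x :+ a) :+ (y :+ b))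
                                                          refl x y (tr k (σ x)) (tr k (σ y)) ⟩
      (x + tr k (σ x)) + (y + tr k (σ y))       ∎

    additive-commutes-with-tr : ∀ φ → (∀ {x y} → x ≈ y → φ x ≈ φ y) → (∀ x y → φ (x + y) ≈ φ x + φ y) →
                                (∀ x → φ (σ x) ≈ σ (φ x)) → ∀ k x → φ (tr k x) ≈ tr k (φ x)
    additive-commutes-with-tr φ φ-cong φ-+ φσ≈σφ zero    x = additive⇒0↦0 φ φ-cong φ-+
    additive-commutes-with-tr φ φ-cong φ-+ φσ≈σφ (suc k) x = trans (φ-+ x _)
      (+-congˡ (trans (additive-commutes-with-tr φ φ-cong φ-+ φσ≈σφ k (σ x)) (tr-cong k (φσ≈σφ x))))

    σ-tr : ∀ k x → σ (tr k x) ≈ tr k (σ x)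
    σ-tr = additive-commutes-with-tr σ σ-cong σ-+ (λ _ → refl)

    tr-scalar : ∀ {c} → σ c ≈ c → ∀ k x → tr k (c * x) ≈ c * tr k x
    tr-scalar {c} σc≈c zero    x = sym (zeroʳ c)
    tr-scalar {c} σc≈c (suc k) x = begin
      c * x + tr k (σ (c * x))  ≈⟨ +-congˡ (tr-cong k (trans (σ-* c x) (*-congʳ σc≈c))) ⟩
      c * x + tr k (c * σ x)    ≈⟨ +-congˡ (tr-scalar σc≈c k (σ x)) ⟩
      c * x + c * tr k (σ x)    ≈⟨ distribˡ c x (tr k (σ x)) ⟨
      c * (x + tr k (σ x))      ∎

    tr-suc : ∀ k x → tr (suc k) x ≈ tr k x + iterate σ x k
    tr-suc zero    x = +-comm x 0#
    tr-suc (suc k) x = begin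
      x + tr (suc k) (σ x)                    ≈⟨ +-congˡ (tr-suc k (σ x)) ⟩
      x + (tr k (σ x) + iterate σ (σ x) k)    ≈⟨ +-assoc x _ _ ⟨
      (x + tr k (σ x)) + iterate σ (σ x) k    ∎

    module Periodic (N : ℕ) (period : ∀ x → iterate σ x N ≈ x) where

      trace : Carrier → Carrier
      trace = tr N

      trace-σ : ∀ x → trace (σ x) ≈ trace x
      trace-σ x = begin
        trace (σ x)                  ≈⟨ solve 2 (λ x t → t := (x :+ t) :+ x) refl x (trace (σ x)) ⟩
        (x + trace (σ x)) + x        ≈⟨ +-congʳ (tr-suc N x) ⟩
        (trace x + iterate σ x N) + x  ≈⟨ +-congʳ (+-congˡ (period x)) ⟩
        (trace x + x) + x            ≈⟨ solve 2 (λ x t → (t :+ x) :+ x := t) refl x (trace x) ⟩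
        trace x                      ∎

      σ-trace : ∀ x → σ (trace x) ≈ trace x
      σ-trace x = trans (σ-tr N x) (trace-σ x)

      trace-AS : ∀ w → trace (w + σ w) ≈ 0#
      trace-AS w = trans (tr-+ N w (σ w)) (trans (+-congˡ (trace-σ w)) (x+x≈0 (trace w)))

      hilbert90 : ∀ {θ x} → trace θ ≈ 1# → trace x ≈ 0# → ∃ λ w → w + σ w ≈ x
      hilbert90 {θ} {x} trθ≈1 trx≈0 = w N , (begin
        w N + σ (w N)                           ≈⟨ solve 2 (λ w v → w :+ v := v :+ (w :+ con false)) refl (w N) (σ (w N)) ⟩
        σ (w N) + (w N + 0#)                    ≈⟨ +-congˡ (+-congˡ (trans (*-congʳ trx≈0) (zeroˡ _))) ⟨
        σ (w N) + (w N + trace x * iterate σ θ N)  ≈⟨ telescope N ⟩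
        x * tr N (σ θ)                          ≈⟨ *-congˡ (trans (trace-σ θ) trθ≈1) ⟩
        x * 1#                                  ≈⟨ *-identityʳ x ⟩
        x                                       ∎)
        where
        -- the classical witness  Σ_{k<N} tr k x · σᵏ θ
        w : ℕ → Carrier
        w zero    = 0#
        w (suc k) = w k + tr k x * iterate σ θ k

        telescope : ∀ k → σ (w k) + w (suc k) ≈ x * tr k (σ θ)
        telescope zero = begin
          σ 0# + (0# + 0# * θ)  ≈⟨ +-cong (additive⇒0↦0 σ σ-cong σ-+) (trans (+-identityˡ _) (zeroˡ θ)) ⟩
          0# + 0#               ≈⟨ +-identityʳ 0# ⟩
          0#                    ≈⟨ zeroʳ x ⟨
          x * 0#                ∎
        telescope (suc k) = begin
          σ (w k + A * B) + (w (suc k) + (x + tr k (σ x)) * iterate σ (σ θ) k)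
            ≈⟨ +-cong (trans (σ-+ (w k) (A * B)) (+-congˡ (σ-* A B)))
                      (+-congˡ (*-cong (+-congˡ (sym (σ-tr k x))) (reflexive (iterate-shift σ θ k)))) ⟩
          (σ (w k) + σ A * σ B) + (w (suc k) + (x + σ A) * σ B)
            ≈⟨ solve 5 (λ w a b v x → (w :+ a :* b) :+ (v :+ (x :+ a) :* b) := (w :+ v) :+ x :* b)
                       refl (σ (w k)) (σ A) (σ B) (w (suc k)) x ⟩
          (σ (w k) + w (suc k)) + x * σ B      ≈⟨ +-congʳ (telescope k) ⟩
          x * tr k (σ θ) + x * σ B             ≈⟨ distribˡ x _ _ ⟨
          x * (tr k (σ θ) + σ B)               ≡⟨ ≡.cong (λ b → x * (tr k (σ θ) + b)) (≡.sym (iterate-shift σ θ k)) ⟩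
          x * (tr k (σ θ) + iterate σ (σ θ) k) ≈⟨ *-congˡ (tr-suc k (σ θ)) ⟨
          x * tr (suc k) (σ θ)                 ∎
          where
          A = tr k x
          B = iterate σ θ k

  module Frobenius = AdditiveTrace sq sq-cong sq-+ sq-*
  open Frobenius.Periodic n frobenius-period using (trace; trace-σ; σ-trace; trace-AS; hilbert90)

  trace-go≡tr : ∀ k x → trace-go k x ≡ Frobenius.tr k x
  trace-go≡tr zero    x = ≡.refl
  trace-go≡tr (suc k) x = ≡.cong (x +_) (trace-go≡tr k (sq x))

  Tr≈trace : ∀ x → Tr x ≈ trace x
  Tr≈trace x = reflexive (trace-go≡tr n x)

  Tr-cong : ∀ {x y} → x ≈ y → Tr x ≈ Tr y
  Tr-cong {x} {y} x≈y = trans (Tr≈trace x) (trans (Frobenius.tr-cong n x≈y) (sym (Tr≈trace y)))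

  Tr-+ : ∀ x y → Tr (x + y) ≈ Tr x + Tr y
  Tr-+ x y = trans (Tr≈trace (x + y)) (trans (Frobenius.tr-+ n x y) (sym (+-cong (Tr≈trace x) (Tr≈trace y))))

  Tr-sq : ∀ x → Tr (sq x) ≈ Tr x
  Tr-sq x = trans (Tr≈trace (sq x)) (trans (trace-σ x) (sym (Tr≈trace x)))

  Tr-AS : ∀ w → Tr (AS w) ≈ 0#
  Tr-AS w = trans (Tr≈trace (AS w)) (trace-AS w)

  Tr-0 : Tr 0# ≈ 0#
  Tr-0 = additive⇒0↦0 Tr Tr-cong Tr-+

  Tr∈𝔽₂ : ∀ x → Tr x ≈ 0# ⊎ Tr x ≈ 1#
  Tr∈𝔽₂ x = sq≈id⇒0∨1 (trans (sq-cong (Tr≈trace x)) (trans (σ-trace x) (sym (Tr≈trace x))))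

  Tr≈0⇒InAS : ∀ {θ x} → Tr θ ≈ 1# → Tr x ≈ 0# → InAS x
  Tr≈0⇒InAS {θ} {x} Trθ≈1 Trx≈0 = hilbert90 (trans (sym (Tr≈trace θ)) Trθ≈1) (trans (sym (Tr≈trace x)) Trx≈0)

  tr-1-step : ∀ k → Frobenius.tr (suc (suc k)) 1# ≈ Frobenius.tr k 1#
  tr-1-step k = begin
    1# + (sq 1# + Frobenius.tr k (sq (sq 1#)))  ≈⟨ +-congˡ (+-cong 1²≈1 (Frobenius.tr-cong k (trans (sq-cong 1²≈1) 1²≈1))) ⟩
    1# + (1# + Frobenius.tr k 1#)               ≈⟨ solve 1 (λ t → con true :+ (con true :+ t) := t) refl _ ⟩
    Frobenius.tr k 1#                           ∎
    where 1²≈1 = *-identityˡ 1#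

  tr-1-even : ∀ m → Frobenius.tr (m +ℕ m) 1# ≈ 0#
  tr-1-even zero    = refl
  tr-1-even (suc m) = trans (reflexive (≡.cong (λ k → Frobenius.tr (suc k) 1#) (ℕ.+-suc m m)))
                            (trans (tr-1-step (m +ℕ m)) (tr-1-even m))

  Tr-1-even : ∀ {m} → n ≡ m +ℕ m → Tr 1# ≈ 0#
  Tr-1-even {m} ≡.refl = trans (Tr≈trace 1#) (tr-1-even m)

  Tr-1-odd : ∀ {m} → n ≡ suc (m +ℕ m) → Tr 1# ≈ 1#
  Tr-1-odd {m} ≡.refl = begin
    Tr 1#                                   ≈⟨ Tr≈trace 1# ⟩
    1# + Frobenius.tr (m +ℕ m) (sq 1#)      ≈⟨ +-congˡ (Frobenius.tr-cong (m +ℕ m) (*-identityˡ 1#)) ⟩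
    1# + Frobenius.tr (m +ℕ m) 1#           ≈⟨ +-congˡ (tr-1-even m) ⟩
    1# + 0#                                 ≈⟨ +-identityʳ 1# ⟩
    1#                                      ∎

  nonSquare⇒Tr[1]≈1 : ¬ IsSquareℕ (2 ^ n) → Tr 1# ≈ 1#
  nonSquare⇒Tr[1]≈1 ¬square = let h , n≡1+h+h = nonSquare⇒odd-exponent ¬square in Tr-1-odd {h} n≡1+h+h

  -- Table 3.1 of Silverman's AEC for a₁ = a₄ = a₁′ = a₄′ = 0, simplified in characteristic 2.
  Curve-≅ : ∀ {a b c a′ b′ c′} U r s t → U ≉ 0# →
            cube U * a′ ≈ a → sq U * b′ ≈ b + r + sq s → s * a ≈ sq r →
            pow6 U * (c′ * sq a′) ≈ c * sq a + sq r * b + cube r + t * a + sq t →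
            Curve a b c ≅ Curve a′ b′ c′
  Curve-≅ {a} {b} {c} {a′} {b′} {c′} U r s t U≉0 a-eq b-eq sa≈r² c-eq =
    U , r , s , t , U≉0 , a₁-eq , a₂-eq , a₃-eq , a₄-eq , a₆-eq
    where
    a₁-eq : U * 0# ≈ 0# + (s + s)
    a₁-eq = trans (zeroʳ U) (solve 1 (λ s → con false := con false :+ (s :+ s)) refl s)
    a₂-eq : sq U * b′ ≈ b + - (s * 0#) + (r + r + r) + - sq s
    a₂-eq = trans b-eq (solve 3 (λ b r s → b :+ r :+ s :* s := b :+ :- (s :* con false) :+ (r :+ r :+ r) :+ :- (s :* s))
                              refl b r s)
    a₃-eq : cube U * a′ ≈ a + r * 0# + (t + t)
    a₃-eq = trans a-eq (solve 3 (λ a r t → a := a :+ r :* con false :+ (t :+ t)) refl a r t)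
    a₄-eq : pow4 U * 0# ≈ 0# + - (s * a) + (r + r) * b + - ((t + r * s) * 0#) + (sq r + sq r + sq r) + - ((s + s) * t)
    a₄-eq = trans (zeroʳ _) (sym (trans
      (solve 5 (λ s a r b t → con false :+ :- (s :* a) :+ (r :+ r) :* b :+ :- ((t :+ r :* s) :* con false)
                              :+ (r :* r :+ r :* r :+ r :* r) :+ :- ((s :+ s) :* t) := s :* a :+ r :* r) refl s a r b t)
      (x≈y⇒x+y≈0 sa≈r²)))
    a₆-eq : pow6 U * (c′ * sq a′) ≈ c * sq a + r * 0# + sq r * b + cube r + - (t * a) + - sq t + - (r * t * 0#)
    a₆-eq = trans c-eq (solve 5 (λ c a r b t → c :* (a :* a) :+ (r :* r) :* b :+ r :* r :* r :+ t :* a :+ t :* t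
      := c :* (a :* a) :+ r :* con false :+ (r :* r) :* b :+ r :* r :* r :+ :- (t :* a) :+ :- (t :* t) :+ :- (r :* t :* con false))
      refl c a r b t)

  pow4≈id⇒cube≈1 : ∀ {x} → pow4 x ≈ x → x ≉ 0# → cube x ≈ 1#
  pow4≈id⇒cube≈1 {x} x⁴≈x x≉0 = sym (x+y≈0⇒x≈y (x*y≈0⇒y≈0 x≉0 (begin
    x * (1# + cube x)  ≈⟨ solve 1 (λ x → x :* (con true :+ x :* x :* x) := x :+ (x :* x) :* (x :* x)) refl x ⟩
    x + pow4 x         ≈⟨ x≈y⇒x+y≈0 (sym x⁴≈x) ⟩
    0#                 ∎)))

  1³*1≈1 : cube 1# * 1# ≈ 1#
  1³*1≈1 = solve 0 ((con true :* con true :* con true) :* con true := con true) refl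

  u²*[b*u⁻²]≈b : ∀ {u} b → u ≉ 0# → sq u * (b * sq (inv u)) ≈ b
  u²*[b*u⁻²]≈b {u} b u≉0 = begin
    sq u * (b * sq (inv u))  ≈⟨ solve 3 (λ u b i → (u :* u) :* (b :* (i :* i)) := b :* ((u :* i) :* (u :* i))) refl u b (inv u) ⟩
    b * sq (u * inv u)       ≈⟨ *-congˡ (trans (sq-cong (inv-law u u≉0)) (*-identityˡ 1#)) ⟩
    b * 1#                   ≈⟨ *-identityʳ b ⟩
    b                        ∎

  AS-cong : ∀ {x y} → x ≈ y → AS x ≈ AS y
  AS-cong x≈y = +-cong x≈y (sq-cong x≈y)

  AS²≈AS∘AS : ∀ ρ → AS² ρ ≈ AS (AS ρ)
  AS²≈AS∘AS = solve 1 (λ r → r :+ (r :* r) :* (r :* r) := (r :+ r :* r) :+ (r :+ r :* r) :* (r :+ r :* r)) refl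

  L : Carrier → Carrier → Carrier
  L a v = v * a + pow4 v * sq a

  L-injective : ∀ {a} → a ≉ 0# → ¬ IsNonzeroCube a → ∀ {x y} → L a x ≈ L a y → x ≈ y
  L-injective {a} a≉0 ¬cube {x} {y} Lx≈Ly with (x + y) ≟ 0#
  ... | yes x+y≈0 = x+y≈0⇒x≈y x+y≈0
  ... | no  d≉0   = ⊥-elim (¬cube (inv d , inv-≉0 d≉0 , d⁻³≈a))
    where
    d = x + y
    d³a≈1 : cube d * a ≈ 1#
    d³a≈1 = sym (x+y≈0⇒x≈y (x*y≈0⇒y≈0 a≉0 (x*y≈0⇒y≈0 d≉0 (begin
      d * (a * (1# + cube d * a))
        ≈⟨ solve 3 (λ x y a → (x :+ y) :* (a :* (con true :+ ((x :+ y) :* (x :+ y) :* (x :+ y)) :* a))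
                     := (x :* a :+ ((x :* x) :* (x :* x)) :* (a :* a)) :+ (y :* a :+ ((y :* y) :* (y :* y)) :* (a :* a))) refl x y a ⟩
      (x * a + pow4 x * sq a) + (y * a + pow4 y * sq a)  ≈⟨ x≈y⇒x+y≈0 Lx≈Ly ⟩
      0#                                                  ∎))))
    d⁻³≈a : cube (inv d) ≈ a
    d⁻³≈a = begin
      cube (inv d)                   ≈⟨ *-identityʳ _ ⟨
      cube (inv d) * 1#              ≈⟨ *-congˡ d³a≈1 ⟨
      cube (inv d) * (cube d * a)    ≈⟨ solve 3 (λ i d a → (i :* i :* i) :* ((d :* d :* d) :* a) := ((d :* i) :* (d :* i) :* (d :* i)) :* a)
                                               refl (inv d) d a ⟩
      cube (d * inv d) * a           ≈⟨ *-congʳ (*-cong (*-cong dd⁻¹≈1 dd⁻¹≈1) dd⁻¹≈1) ⟩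
      cube 1# * a                    ≈⟨ solve 1 (λ a → (con true :* con true :* con true) :* a := a) refl a ⟩
      a                              ∎
      where dd⁻¹≈1 = inv-law d d≉0

  L-surjective : ∀ {a} → a ≉ 0# → ¬ IsNonzeroCube a → ∀ b → ∃ λ v → L a v ≈ b
  L-surjective a≉0 ¬cube = injective⇒surjective distinct complete (L-injective a≉0 ¬cube)

  InAS²⇒L-solvable : ∀ {a b u} → u ≉ 0# → cube u ≈ a → InAS² (b * sq (inv u)) → ∃ λ v → L a v ≈ b
  InAS²⇒L-solvable {a} {b} {u} u≉0 u³≈a (w , AS²w≈β) = w * inv u , (begin
    w * i * a + pow4 (w * i) * sq a
      ≈⟨ +-cong (*-congˡ (sym u³≈a)) (*-congˡ (sq-cong (sym u³≈a))) ⟩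
    w * i * cube u + pow4 (w * i) * sq (cube u)
      ≈⟨ solve 3 (λ w i u → w :* i :* (u :* u :* u) :+ (((w :* i) :* (w :* i)) :* ((w :* i) :* (w :* i))) :* ((u :* u :* u) :* (u :* u :* u))
                   := (u :* u) :* (w :* (u :* i) :+ ((w :* w) :* (w :* w)) :* (((u :* i) :* (u :* i)) :* ((u :* i) :* (u :* i))))) refl w i u ⟩
    sq u * (w * (u * i) + pow4 w * pow4 (u * i))
      ≈⟨ *-congˡ (+-cong (*-congˡ ui≈1) (*-congˡ (pow4-cong ui≈1))) ⟩
    sq u * (w * 1# + pow4 w * pow4 1#)
      ≈⟨ *-congˡ (solve 2 (λ w w⁴ → w :* con true :+ w⁴ :* ((con true :* con true) :* (con true :* con true)) := w :+ w⁴)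
                          refl w (pow4 w)) ⟩
    sq u * AS² w             ≈⟨ *-congˡ AS²w≈β ⟩
    sq u * (b * sq i)        ≈⟨ u²*[b*u⁻²]≈b b u≉0 ⟩
    b                        ∎)
    where
    i = inv u
    ui≈1 = inv-law u u≉0

  L-solvable : ∀ {a b} → a ≉ 0# → (¬ IsNonzeroCube a ⊎ (∃ λ u → u ≉ 0# × cube u ≈ a × InAS² (b * sq (inv u)))) →
               ∃ λ v → L a v ≈ b
  L-solvable {b = b} a≉0 =
    [ (λ ¬cube → L-surjective a≉0 ¬cube b) , (λ (_ , u≉0 , u³≈a , β∈AS²) → InAS²⇒L-solvable u≉0 u³≈a β∈AS²) ]′

  -- For ε ∈ 𝔽₄ the cross terms ρ₀² ε + ρ₀ ε² of the constant term at ρ₀ + ε equal AS (ρ₀ ε²), of trace 0.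
  shift-to-trace-zero : ∀ {β c x ρ₀ ε} → AS² ρ₀ ≈ x → pow4 ε ≈ ε → Tr (sq ε * β + cube ε) ≈ 1# →
                        ∃ λ ρ → AS² ρ ≈ x × Tr (c + sq ρ * β + cube ρ) ≈ 0#
  shift-to-trace-zero {β} {c} {x} {ρ₀} {ε} AS²ρ₀≈x ε⁴≈ε Tr[ε²β+ε³]≈1 =
    [ (λ Tr[f₀]≈0 → ρ₀ , AS²ρ₀≈x , Tr[f₀]≈0)
    , (λ Tr[f₀]≈1 → ρ₀ + ε , AS²[ρ₀+ε]≈x , Tr[f[ρ₀+ε]]≈0 Tr[f₀]≈1)
    ]′ (Tr∈𝔽₂ f₀)
    where
    f₀ = c + sq ρ₀ * β + cube ρ₀
    AS[ρ₀ε²]≈ : AS (ρ₀ * sq ε) ≈ ρ₀ * sq ε + sq ρ₀ * ε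
    AS[ρ₀ε²]≈ = +-congˡ (trans (sq-* ρ₀ (sq ε)) (*-congˡ ε⁴≈ε))
    Tr[f[ρ₀+ε]]≈0 : Tr f₀ ≈ 1# → Tr (c + sq (ρ₀ + ε) * β + cube (ρ₀ + ε)) ≈ 0#
    Tr[f[ρ₀+ε]]≈0 Tr[f₀]≈1 = begin
      Tr (c + sq (ρ₀ + ε) * β + cube (ρ₀ + ε))
        ≈⟨ Tr-cong (solve 4 (λ c r e β → c :+ ((r :+ e) :* (r :+ e)) :* β :+ (r :+ e) :* (r :+ e) :* (r :+ e)
                              := (c :+ (r :* r) :* β :+ r :* r :* r) :+ ((e :* e) :* β :+ e :* e :* e) :+ (r :* (e :* e) :+ (r :* r) :* e))
                              refl c ρ₀ ε β) ⟩
      Tr (f₀ + (sq ε * β + cube ε) + (ρ₀ * sq ε + sq ρ₀ * ε))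
        ≈⟨ Tr-cong (+-congˡ (sym AS[ρ₀ε²]≈)) ⟩
      Tr (f₀ + (sq ε * β + cube ε) + AS (ρ₀ * sq ε))
        ≈⟨ trans (Tr-+ _ _) (+-congʳ (Tr-+ _ _)) ⟩
      Tr f₀ + Tr (sq ε * β + cube ε) + Tr (AS (ρ₀ * sq ε))
        ≈⟨ +-cong (+-cong Tr[f₀]≈1 Tr[ε²β+ε³]≈1) (Tr-AS _) ⟩
      1# + 1# + 0#
        ≈⟨ solve 0 (con true :+ con true :+ con false := con false) refl ⟩
      0# ∎
    AS²[ρ₀+ε]≈x : AS² (ρ₀ + ε) ≈ x
    AS²[ρ₀+ε]≈x = begin
      (ρ₀ + ε) + pow4 (ρ₀ + ε)     ≈⟨ +-congˡ (trans (pow4-+ ρ₀ ε) (+-congˡ ε⁴≈ε)) ⟩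
      (ρ₀ + ε) + (pow4 ρ₀ + ε)     ≈⟨ solve 3 (λ r e r⁴ → (r :+ e) :+ (r⁴ :+ e) := r :+ r⁴) refl ρ₀ ε (pow4 ρ₀) ⟩
      AS² ρ₀                        ≈⟨ AS²ρ₀≈x ⟩
      x                             ∎

  module RelativeTrace (m : ℕ) (n≡m+m : n ≡ m +ℕ m) where

    pow4-period : ∀ x → iterate pow4 x m ≈ x
    pow4-period x = trans (reflexive (≡.trans (iterate-∘-twice sq x m) (≡.cong (iterate sq x) (≡.sym n≡m+m))))
                          (frobenius-period x)

    module Tr₄-sum = AdditiveTrace pow4 pow4-cong pow4-+ pow4-*
    open Tr₄-sum.Periodic m pow4-period public
      using () renaming (trace to Tr₄; σ-trace to pow4-Tr₄; hilbert90 to Tr₄≈0⇒InAS²)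

    Tr₄-scalar : ∀ {c} → pow4 c ≈ c → ∀ x → Tr₄ (c * x) ≈ c * Tr₄ x
    Tr₄-scalar c⁴≈c = Tr₄-sum.tr-scalar c⁴≈c m

    Tr₄-cong : ∀ {x y} → x ≈ y → Tr₄ x ≈ Tr₄ y
    Tr₄-cong = Tr₄-sum.tr-cong m

    Tr₄-+ : ∀ x y → Tr₄ (x + y) ≈ Tr₄ x + Tr₄ y
    Tr₄-+ = Tr₄-sum.tr-+ m

    Tr₄-sq : ∀ x → Tr₄ (sq x) ≈ sq (Tr₄ x)
    Tr₄-sq x = sym (Tr₄-sum.additive-commutes-with-tr sq sq-cong sq-+ (λ _ → refl) m x)

    tr-double≈AS∘tr₄ : ∀ k x → Frobenius.tr (k +ℕ k) x ≈ AS (Tr₄-sum.tr k x)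
    tr-double≈AS∘tr₄ zero    x = sym (trans (+-identityˡ _) (zeroˡ 0#))
    tr-double≈AS∘tr₄ (suc k) x = begin
      Frobenius.tr (suc (k +ℕ suc k)) x            ≡⟨ ≡.cong (λ j → Frobenius.tr (suc j) x) (ℕ.+-suc k k) ⟩
      x + (sq x + Frobenius.tr (k +ℕ k) (pow4 x))  ≈⟨ +-congˡ (+-congˡ (tr-double≈AS∘tr₄ k (pow4 x))) ⟩
      x + (sq x + AS y)                            ≈⟨ solve 2 (λ x y → x :+ (x :* x :+ (y :+ y :* y)) := (x :+ y) :+ (x :+ y) :* (x :+ y))
                                                              refl x y ⟩
      AS (x + y)                                   ∎
      where y = Tr₄-sum.tr k (pow4 x)

    Tr≈AS∘Tr₄ : ∀ x → Tr x ≈ AS (Tr₄ x)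
    Tr≈AS∘Tr₄ x = trans (Tr≈trace x) (trans (reflexive (≡.cong (λ j → Frobenius.tr j x) n≡m+m)) (tr-double≈AS∘tr₄ m x))

  module Classification (c₀ : Carrier) (Tr[c₀]≈1 : Tr c₀ ≈ 1#) where

    ker-Tr⊆AS : ∀ {x} → Tr x ≈ 0# → InAS x
    ker-Tr⊆AS = Tr≈0⇒InAS Tr[c₀]≈1

    c₀≉0 : c₀ ≉ 0#
    c₀≉0 c₀≈0 = nontrivial (trans (sym Tr[c₀]≈1) (trans (Tr-cong c₀≈0) Tr-0))

    Tr[0#+x]≈0 : ∀ {x} → Tr x ≈ 0# → Tr (0# + x) ≈ 0#
    Tr[0#+x]≈0 Trx≈0 = trans (Tr-cong (+-identityˡ _)) Trx≈0

    Tr[c₀+x]≈0 : ∀ {x} → Tr x ≈ 1# → Tr (c₀ + x) ≈ 0#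
    Tr[c₀+x]≈0 {x} Trx≈1 = trans (Tr-+ c₀ x) (trans (+-cong Tr[c₀]≈1 Trx≈1) char2)

    ≅-without-x² : ∀ {a b c c′} v → L a v ≈ b → Tr (c′ + (c + cube v * a)) ≈ 0# →
                   Curve a b c ≅ Curve a 0# c′
    ≅-without-x² {a} {b} {c} {c′} v L[v]≈b Tr≈0 =
      Curve-≅ 1# (a * v) (a * sq v) (a * z) nontrivial a-eq b-eq s-eq c-eq
      where
      d = c′ + (c + sq (cube v * a))
      Trd≈0 : Tr d ≈ 0#
      Trd≈0 = begin
        Tr d                                   ≈⟨ trans (Tr-+ c′ _) (+-congˡ (trans (Tr-+ c _) (+-congˡ (Tr-sq _)))) ⟩
        Tr c′ + (Tr c + Tr (cube v * a))       ≈⟨ trans (+-congˡ (sym (Tr-+ c _))) (sym (Tr-+ c′ _)) ⟩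
        Tr (c′ + (c + cube v * a))             ≈⟨ Tr≈0 ⟩
        0#                                     ∎
      z = proj₁ (ker-Tr⊆AS Trd≈0)
      a-eq : cube 1# * a ≈ a
      a-eq = solve 1 (λ a → (con true :* con true :* con true) :* a := a) refl a
      b-eq : sq 1# * 0# ≈ b + a * v + sq (a * sq v)
      b-eq = begin
        sq 1# * 0#                         ≈⟨ zeroʳ _ ⟩
        0#                                 ≈⟨ x≈y⇒x+y≈0 L[v]≈b ⟨
        (v * a + pow4 v * sq a) + b        ≈⟨ solve 3 (λ b a v → (v :* a :+ ((v :* v) :* (v :* v)) :* (a :* a)) :+ b
                                                      := b :+ a :* v :+ (a :* (v :* v)) :* (a :* (v :* v))) refl b a v ⟩
        b + a * v + sq (a * sq v)          ∎
      s-eq : a * sq v * a ≈ sq (a * v)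
      s-eq = solve 2 (λ a v → a :* (v :* v) :* a := (a :* v) :* (a :* v)) refl a v
      c-eq : pow6 1# * (c′ * sq a) ≈ c * sq a + sq (a * v) * b + cube (a * v) + a * z * a + sq (a * z)
      c-eq = begin
        pow6 1# * (c′ * sq a)
          ≈⟨ solve 4 (λ c′ c a X → ((con true :* con true :* con true) :* (con true :* con true :* con true)) :* (c′ :* (a :* a))
                                   := (a :* a) :* (c :+ X :+ (c′ :+ (c :+ X)))) refl c′ c a (sq (cube v * a)) ⟩
        sq a * (c + sq (cube v * a) + d)       ≈⟨ *-congˡ (+-congˡ (sym (proj₂ (ker-Tr⊆AS Trd≈0)))) ⟩
        sq a * (c + sq (cube v * a) + AS z)
          ≈⟨ solve 4 (λ a v c z → (a :* a) :* (c :+ ((v :* v :* v) :* a) :* ((v :* v :* v) :* a) :+ (z :+ z :* z))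
                                  := c :* (a :* a) :+ (a :* v) :* (a :* v) :* (v :* a :+ ((v :* v) :* (v :* v)) :* (a :* a))
                                     :+ (a :* v) :* (a :* v) :* (a :* v) :+ a :* z :* a :+ (a :* z) :* (a :* z))
                     refl a v c z ⟩
        c * sq a + sq (a * v) * (v * a + pow4 v * sq a) + cube (a * v) + a * z * a + sq (a * z)
                                               ≈⟨ +-congʳ (+-congʳ (+-congʳ (+-congˡ (*-congˡ L[v]≈b)))) ⟩
        c * sq a + sq (a * v) * b + cube (a * v) + a * z * a + sq (a * z)  ∎

    ≅-via-cube-root : ∀ {a b c a′ b′ c′} u μ ρ → u ≉ 0# → cube u ≈ a → μ ≉ 0# → cube μ * a′ ≈ 1# →
                      sq μ * b′ ≈ b * sq (inv u) + ρ + pow4 ρ →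
                      Tr (c′ + (c + sq ρ * (b * sq (inv u)) + cube ρ)) ≈ 0# →
                      Curve a b c ≅ Curve a′ b′ c′
    ≅-via-cube-root {a} {b} {c} {a′} {b′} {c′} u μ ρ u≉0 u³≈a μ≉0 μ³a′≈1 b′-eq Tr≈0 =
      Curve-≅ (u * μ) (sq u * ρ) (u * sq ρ) (cube u * τ) (*-≉0 u≉0 μ≉0) a-eq b-eq s-eq c-eq
      where
      β = b * sq (inv u)
      f = c + sq ρ * β + cube ρ
      τ = proj₁ (ker-Tr⊆AS Tr≈0)
      u²β≈b : sq u * β ≈ b
      u²β≈b = u²*[b*u⁻²]≈b b u≉0
      a-eq : cube (u * μ) * a′ ≈ a
      a-eq = begin
        cube (u * μ) * a′     ≈⟨ solve 3 (λ u μ a → ((u :* μ) :* (u :* μ) :* (u :* μ)) :* a := (u :* u :* u) :* ((μ :* μ :* μ) :* a))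
                                        refl u μ a′ ⟩
        cube u * (cube μ * a′)  ≈⟨ *-congˡ μ³a′≈1 ⟩
        cube u * 1#           ≈⟨ *-identityʳ _ ⟩
        cube u                ≈⟨ u³≈a ⟩
        a                     ∎
      b-eq : sq (u * μ) * b′ ≈ b + sq u * ρ + sq (u * sq ρ)
      b-eq = begin
        sq (u * μ) * b′       ≈⟨ solve 3 (λ u μ b → ((u :* μ) :* (u :* μ)) :* b := (u :* u) :* ((μ :* μ) :* b)) refl u μ b′ ⟩
        sq u * (sq μ * b′)    ≈⟨ *-congˡ b′-eq ⟩
        sq u * (β + ρ + pow4 ρ)  ≈⟨ solve 3 (λ u β ρ → (u :* u) :* (β :+ ρ :+ (ρ :* ρ) :* (ρ :* ρ))
                                                := (u :* u) :* β :+ (u :* u) :* ρ :+ (u :* (ρ :* ρ)) :* (u :* (ρ :* ρ))) refl u β ρ ⟩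
        sq u * β + sq u * ρ + sq (u * sq ρ)  ≈⟨ +-congʳ (+-congʳ u²β≈b) ⟩
        b + sq u * ρ + sq (u * sq ρ)         ∎
      s-eq : u * sq ρ * a ≈ sq (sq u * ρ)
      s-eq = begin
        u * sq ρ * a        ≈⟨ *-congˡ u³≈a ⟨
        u * sq ρ * cube u   ≈⟨ solve 2 (λ u ρ → u :* (ρ :* ρ) :* (u :* u :* u) := ((u :* u) :* ρ) :* ((u :* u) :* ρ)) refl u ρ ⟩
        sq (sq u * ρ)       ∎
      c-eq : pow6 (u * μ) * (c′ * sq a′) ≈ c * sq a + sq (sq u * ρ) * b + cube (sq u * ρ) + cube u * τ * a + sq (cube u * τ)
      c-eq = begin
        pow6 (u * μ) * (c′ * sq a′)
          ≈⟨ solve 4 (λ u μ c a → ((u :* μ) :* (u :* μ) :* (u :* μ)) :* ((u :* μ) :* (u :* μ) :* (u :* μ)) :* (c :* (a :* a))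
                                  := ((u :* u :* u) :* (u :* u :* u)) :* (c :* (((μ :* μ :* μ) :* a) :* ((μ :* μ :* μ) :* a))))
                     refl u μ c′ a′ ⟩
        pow6 u * (c′ * sq (cube μ * a′))      ≈⟨ *-congˡ (*-congˡ (trans (sq-cong μ³a′≈1) (*-identityˡ 1#))) ⟩
        pow6 u * (c′ * 1#)                    ≈⟨ *-congˡ (solve 2 (λ c′ f → c′ :* con true := f :+ (c′ :+ f)) refl c′ f) ⟩
        pow6 u * (f + (c′ + f))               ≈⟨ *-congˡ (+-congˡ (sym (proj₂ (ker-Tr⊆AS Tr≈0)))) ⟩
        pow6 u * (f + AS τ)
          ≈⟨ solve 5 (λ u ρ τ β c → ((u :* u :* u) :* (u :* u :* u)) :* (c :+ (ρ :* ρ) :* β :+ ρ :* ρ :* ρ :+ (τ :+ τ :* τ))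
                                    := c :* ((u :* u :* u) :* (u :* u :* u)) :+ ((u :* u) :* ρ) :* ((u :* u) :* ρ) :* ((u :* u) :* β)
                                       :+ ((u :* u) :* ρ) :* ((u :* u) :* ρ) :* ((u :* u) :* ρ) :+ (u :* u :* u) :* τ :* (u :* u :* u)
                                       :+ ((u :* u :* u) :* τ) :* ((u :* u :* u) :* τ)) refl u ρ τ β c ⟩
        c * sq (cube u) + sq (sq u * ρ) * (sq u * β) + cube (sq u * ρ) + cube u * τ * cube u + sq (cube u * τ)
          ≈⟨ +-congʳ (+-cong (+-congʳ (+-cong (*-congˡ (sq-cong u³≈a)) (*-congˡ u²β≈b))) (*-congˡ u³≈a)) ⟩
        c * sq a + sq (sq u * ρ) * b + cube (sq u * ρ) + cube u * τ * a + sq (cube u * τ)  ∎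

    E[a]-models : ∀ {a b c} v → L a v ≈ b →
                  (Tr (c + cube v * a) ≈ 0# → Curve a b c ≅ E[ a ]) × (Tr (c + cube v * a) ≈ 1# → Curve a b c ≅ E[ a ]′ c₀)
    E[a]-models v L[v]≈b = (λ Tr≈0 → ≅-without-x² v L[v]≈b (Tr[0#+x]≈0 Tr≈0))
                         , (λ Tr≈1 → ≅-without-x² v L[v]≈b (Tr[c₀+x]≈0 Tr≈1))

    H-models : ∀ {a b c u v} → u ≉ 0# → cube u ≈ a → 1# + v + pow4 v ≈ b * sq (inv u) →
               (Tr (c + cube v + v) ≈ 0# → Curve a b c ≅ H) × (Tr (c + cube v + v) ≈ 1# → Curve a b c ≅ H′ c₀)
    H-models {a} {b} {c} {u} {v} u≉0 u³≈a 1+AS²v≈β = (λ Tr≈0 → to-H (Tr[0#+x]≈0 Tr≈0)) , (λ Tr≈1 → to-H (Tr[c₀+x]≈0 Tr≈1))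
      where
      β = b * sq (inv u)
      b′-eq : sq 1# * 1# ≈ β + v + pow4 v
      b′-eq = begin
        sq 1# * 1#                        ≈⟨ solve 1 (λ v → (con true :* con true) :* con true
                                                       := (con true :+ v :+ (v :* v) :* (v :* v)) :+ v :+ (v :* v) :* (v :* v)) refl v ⟩
        (1# + v + pow4 v) + v + pow4 v    ≈⟨ +-congʳ (+-congʳ 1+AS²v≈β) ⟩
        β + v + pow4 v                    ∎
      Tr-eq : ∀ c′ → Tr (c′ + (c + sq v * β + cube v)) ≈ Tr (c′ + (c + cube v + v))
      Tr-eq c′ = begin
        Tr (c′ + (c + sq v * β + cube v))                 ≈⟨ Tr-cong (+-congˡ (+-congʳ (+-congˡ (*-congˡ (sym 1+AS²v≈β))))) ⟩
        Tr (c′ + (c + sq v * (1# + v + pow4 v) + cube v))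
          ≈⟨ Tr-cong (solve 3 (λ c′ c v → c′ :+ (c :+ (v :* v) :* (con true :+ v :+ (v :* v) :* (v :* v)) :+ v :* v :* v)
                                := (c′ :+ (c :+ v :* v :* v :+ v)) :+ ((v :+ v :* v :* v) :+ (v :+ v :* v :* v) :* (v :+ v :* v :* v)))
                                refl c′ c v) ⟩
        Tr ((c′ + (c + cube v + v)) + AS (v + cube v))    ≈⟨ trans (Tr-+ _ _) (trans (+-congˡ (Tr-AS _)) (+-identityʳ _)) ⟩
        Tr (c′ + (c + cube v + v))                        ∎
      to-H : ∀ {c′} → Tr (c′ + (c + cube v + v)) ≈ 0# → Curve a b c ≅ Curve 1# 1# c′
      to-H {c′} Tr≈0 = ≅-via-cube-root u 1# v u≉0 u³≈a nontrivial 1³*1≈1 b′-eq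
                                          (trans (Tr-eq c′) Tr≈0)

    module OddDegree (Tr[1]≈1 : Tr 1# ≈ 1#) where

      AS-root-in-ker-Tr : ∀ {x} → InAS x → ∃ λ w → Tr w ≈ 0# × AS w ≈ x
      AS-root-in-ker-Tr {x} (w , AS[w]≈x) =
        [ (λ Trw≈0 → w , Trw≈0 , AS[w]≈x) , (λ Trw≈1 → w + 1# , Tr[w+1]≈0 Trw≈1 , AS[w+1]≈x) ]′ (Tr∈𝔽₂ w)
        where
        Tr[w+1]≈0 : Tr w ≈ 1# → Tr (w + 1#) ≈ 0#
        Tr[w+1]≈0 Trw≈1 = trans (Tr-+ w 1#) (trans (+-cong Trw≈1 Tr[1]≈1) char2)
        AS[w+1]≈x : AS (w + 1#) ≈ x
        AS[w+1]≈x = trans (solve 1 (λ w → (w :+ con true) :+ (w :+ con true) :* (w :+ con true) := w :+ w :* w) refl w) AS[w]≈x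

      Tr≈0⇒InAS² : ∀ {x} → Tr x ≈ 0# → InAS² x
      Tr≈0⇒InAS² {x} Trx≈0 =
        let w , Trw≈0 , AS[w]≈x = AS-root-in-ker-Tr (ker-Tr⊆AS Trx≈0)
            ρ , AS[ρ]≈w = ker-Tr⊆AS Trw≈0
        in ρ , trans (AS²≈AS∘AS ρ) (trans (AS-cong AS[ρ]≈w) AS[w]≈x)

      E₁-model : ∀ {a b c u} → u ≉ 0# → cube u ≈ a → InAS (b * sq (inv u)) → Curve a b c ≅ E₁
      E₁-model {a} {b} {c} {u} u≉0 u³≈a (w , AS[w]≈β) =
        to-E₁ (shift-to-trace-zero (proj₂ (Tr≈0⇒InAS² Trβ≈0)) pow4[1]≈1 Tr[1²β+1³]≈1)
        where
        β = b * sq (inv u)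
        Trβ≈0 : Tr β ≈ 0#
        Trβ≈0 = trans (Tr-cong (sym AS[w]≈β)) (Tr-AS w)
        pow4[1]≈1 : pow4 1# ≈ 1#
        pow4[1]≈1 = solve 0 ((con true :* con true) :* (con true :* con true) := con true) refl
        Tr[1²β+1³]≈1 : Tr (sq 1# * β + cube 1#) ≈ 1#
        Tr[1²β+1³]≈1 = begin
          Tr (sq 1# * β + cube 1#)  ≈⟨ Tr-cong (solve 1 (λ β → (con true :* con true) :* β :+ con true :* con true :* con true
                                                              := β :+ con true) refl β) ⟩
          Tr (β + 1#)               ≈⟨ trans (Tr-+ β 1#) (+-cong Trβ≈0 Tr[1]≈1) ⟩
          0# + 1#                   ≈⟨ +-identityˡ 1# ⟩
          1#                        ∎
        to-E₁ : (∃ λ ρ → AS² ρ ≈ β × Tr (c + sq ρ * β + cube ρ) ≈ 0#) → Curve a b c ≅ E₁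
        to-E₁ (ρ , AS²ρ≈β , Tr≈0) = ≅-via-cube-root u 1# ρ u≉0 u³≈a nontrivial 1³*1≈1 b′-eq (Tr[0#+x]≈0 Tr≈0)
          where
          b′-eq : sq 1# * 0# ≈ β + ρ + pow4 ρ
          b′-eq = trans (zeroʳ _) (sym (trans (+-assoc β ρ (pow4 ρ)) (x≈y⇒x+y≈0 (sym AS²ρ≈β))))

      H-solvable : ∀ {β} → ¬ InAS β → ∃ λ v → 1# + v + pow4 v ≈ β
      H-solvable {β} β∉AS = let ρ , AS²ρ≈β+1 = Tr≈0⇒InAS² Tr[β+1]≈0 in ρ , (begin
        1# + ρ + pow4 ρ    ≈⟨ solve 2 (λ ρ ρ⁴ → con true :+ ρ :+ ρ⁴ := (ρ :+ ρ⁴) :+ con true) refl ρ (pow4 ρ) ⟩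
        AS² ρ + 1#         ≈⟨ +-congʳ AS²ρ≈β+1 ⟩
        β + 1# + 1#        ≈⟨ solve 1 (λ β → β :+ con true :+ con true := β) refl β ⟩
        β                  ∎)
        where
        Trβ≈1 : Tr β ≈ 1#
        Trβ≈1 = [ (λ Trβ≈0 → ⊥-elim (β∉AS (ker-Tr⊆AS Trβ≈0))) , (λ Trβ≈1 → Trβ≈1) ]′ (Tr∈𝔽₂ β)
        Tr[β+1]≈0 : Tr (β + 1#) ≈ 0#
        Tr[β+1]≈0 = trans (Tr-+ β 1#) (trans (+-cong Trβ≈1 Tr[1]≈1) char2)

    module EvenDegree (m : ℕ) (n≡m+m : n ≡ m +ℕ m) where
      open RelativeTrace m n≡m+m

      T = Tr₄ c₀

      AS[T]≈1 : AS T ≈ 1#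
      AS[T]≈1 = trans (sym (Tr≈AS∘Tr₄ c₀)) Tr[c₀]≈1

      T≉0 : T ≉ 0#
      T≉0 T≈0 = nontrivial (trans (sym AS[T]≈1) (trans (+-cong T≈0 (sq-cong T≈0)) (trans (+-identityˡ _) (zeroˡ 0#))))

      T³≈1 : cube T ≈ 1#
      T³≈1 = pow4≈id⇒cube≈1 (pow4-Tr₄ c₀) T≉0

      ker-Tr₄⊆AS² : ∀ {x} → Tr₄ x ≈ 0# → InAS² x
      ker-Tr₄⊆AS² = Tr₄≈0⇒InAS² (begin
        Tr₄ (sq T * c₀)   ≈⟨ Tr₄-scalar (sq-cong (pow4-Tr₄ c₀)) c₀ ⟩
        cube T            ≈⟨ T³≈1 ⟩
        1#                ∎)

      -- t = Tr₄ β and T = Tr₄ c₀ lie in 𝔽₄*, and μ = (t T)² c₀ is chosen so that Tr₄ (β + μ²) = t + t T³ = 0.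
      module Twist {β} (β∉AS² : ¬ InAS² β) where

        t = Tr₄ β

        t≉0 : t ≉ 0#
        t≉0 t≈0 = β∉AS² (ker-Tr₄⊆AS² t≈0)

        t³≈1 : cube t ≈ 1#
        t³≈1 = pow4≈id⇒cube≈1 (pow4-Tr₄ β) t≉0

        κ = t * T

        κ≉0 : κ ≉ 0#
        κ≉0 = *-≉0 t≉0 T≉0

        κ⁴≈κ : pow4 κ ≈ κ
        κ⁴≈κ = trans (pow4-* t T) (*-cong (pow4-Tr₄ β) (pow4-Tr₄ c₀))

        κ³≈1 : cube κ ≈ 1#
        κ³≈1 = pow4≈id⇒cube≈1 κ⁴≈κ κ≉0

        μ = sq κ * c₀

        μ≉0 : μ ≉ 0#
        μ≉0 = *-≉0 (*-≉0 κ≉0 κ≉0) c₀≉0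

        μ³c₀⁻³≈1 : cube μ * cube (inv c₀) ≈ 1#
        μ³c₀⁻³≈1 = begin
          cube (sq κ * c₀) * cube (inv c₀)
            ≈⟨ solve 3 (λ κ c i → ((κ :* κ) :* c) :* ((κ :* κ) :* c) :* ((κ :* κ) :* c) :* (i :* i :* i)
                                  := ((κ :* κ :* κ) :* (κ :* κ :* κ)) :* ((c :* i) :* (c :* i) :* (c :* i))) refl κ c₀ (inv c₀) ⟩
          sq (cube κ) * cube (c₀ * inv c₀)  ≈⟨ *-cong (sq-cong κ³≈1) (*-cong (*-cong c₀c₀⁻¹≈1 c₀c₀⁻¹≈1) c₀c₀⁻¹≈1) ⟩
          sq 1# * cube 1#                   ≈⟨ solve 0 ((con true :* con true) :* (con true :* con true :* con true) := con true) refl ⟩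
          1#                                ∎
          where c₀c₀⁻¹≈1 = inv-law c₀ c₀≉0

        Tr₄[β+μ²]≈0 : Tr₄ (β + sq μ) ≈ 0#
        Tr₄[β+μ²]≈0 = begin
          Tr₄ (β + sq μ)              ≈⟨ trans (Tr₄-+ β (sq μ)) (+-congˡ (Tr₄-cong (sq-* (sq κ) c₀))) ⟩
          t + Tr₄ (pow4 κ * sq c₀)    ≈⟨ +-congˡ (Tr₄-scalar (pow4-cong κ⁴≈κ) (sq c₀)) ⟩
          t + pow4 κ * Tr₄ (sq c₀)    ≈⟨ +-congˡ (*-cong κ⁴≈κ (Tr₄-sq c₀)) ⟩
          t + t * T * sq T            ≈⟨ +-congˡ (solve 2 (λ t T → t :* T :* (T :* T) := t :* (T :* T :* T)) refl t T) ⟩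
          t + t * cube T              ≈⟨ +-congˡ (trans (*-congˡ T³≈1) (*-identityʳ t)) ⟩
          t + t                       ≈⟨ x+x≈0 t ⟩
          0#                          ∎

        Tr₄[κ²β]≈T² : Tr₄ (sq κ * β) ≈ sq T
        Tr₄[κ²β]≈T² = begin
          Tr₄ (sq κ * β)    ≈⟨ Tr₄-scalar (sq-cong κ⁴≈κ) β ⟩
          sq κ * t          ≈⟨ solve 2 (λ t T → ((t :* T) :* (t :* T)) :* t := (t :* t :* t) :* (T :* T)) refl t T ⟩
          cube t * sq T     ≈⟨ trans (*-congʳ t³≈1) (*-identityˡ (sq T)) ⟩
          sq T              ∎

        Tr[κ²β+κ³]≈1 : Tr (sq κ * β + cube κ) ≈ 1#
        Tr[κ²β+κ³]≈1 = begin
          Tr (sq κ * β + cube κ)      ≈⟨ trans (Tr-+ _ _) (+-cong (Tr≈AS∘Tr₄ _) (trans (Tr-cong κ³≈1) (Tr-1-even {m} n≡m+m))) ⟩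
          AS (Tr₄ (sq κ * β)) + 0#    ≈⟨ trans (+-identityʳ _) (AS-cong Tr₄[κ²β]≈T²) ⟩
          sq T + sq (sq T)            ≈⟨ trans (+-congˡ (pow4-Tr₄ c₀)) (+-comm (sq T) T) ⟩
          AS T                        ≈⟨ AS[T]≈1 ⟩
          1#                          ∎

      E₀-model : ∀ {a b c u} → u ≉ 0# → cube u ≈ a → ¬ InAS² (b * sq (inv u)) → Curve a b c ≅ E₀ c₀
      E₀-model {a} {b} {c} {u} u≉0 u³≈a β∉AS² =
        to-E₀ (shift-to-trace-zero (proj₂ (ker-Tr₄⊆AS² Tr₄[β+μ²]≈0)) κ⁴≈κ Tr[κ²β+κ³]≈1)
        where
        open Twist β∉AS²
        β = b * sq (inv u)
        to-E₀ : (∃ λ ρ → AS² ρ ≈ β + sq μ × Tr (c + sq ρ * β + cube ρ) ≈ 0#) → Curve a b c ≅ E₀ c₀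
        to-E₀ (ρ , AS²ρ≈β+μ² , Tr≈0) = ≅-via-cube-root u μ ρ u≉0 u³≈a μ≉0 μ³c₀⁻³≈1 b′-eq (Tr[0#+x]≈0 Tr≈0)
          where
          b′-eq : sq μ * 1# ≈ β + ρ + pow4 ρ
          b′-eq = begin
            sq μ * 1#          ≈⟨ solve 2 (λ β m → m :* con true := β :+ (β :+ m)) refl β (sq μ) ⟩
            β + (β + sq μ)     ≈⟨ +-congˡ (sym AS²ρ≈β+μ²) ⟩
            β + AS² ρ          ≈⟨ +-assoc β ρ (pow4 ρ) ⟨
            β + ρ + pow4 ρ     ∎

proposition1p4 :
    (n : ℕ) (F : FiniteField2 n) →
    let open FieldDefs F in
    (c₀ : Carrier) → Tr c₀ ≈ 1# →
    (a b c : Carrier) → ¬ (a ≈ 0#) → (c ≈ 0# ⊎ c ≈ c₀) →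
    -- (1) q = 2^n is a square
    (IsSquareℕ (2 ^ n) →
        (((¬ IsNonzeroCube a)
           ⊎ (∃ λ u → ¬ (u ≈ 0#) × cube u ≈ a × InAS² (b * sq (inv u)))) →
          (∃ λ v → v * a + pow4 v * sq a ≈ b)
          × (∀ v → v * a + pow4 v * sq a ≈ b →
               (Tr (c + cube v * a) ≈ 0# → Curve a b c ≅ E[ a ])
               × (Tr (c + cube v * a) ≈ 1# → Curve a b c ≅ E[ a ]′ c₀)))
      × (∀ u → ¬ (u ≈ 0#) → cube u ≈ a → ¬ InAS² (b * sq (inv u)) →
          Curve a b c ≅ E₀ c₀))
    ×
    -- (2) q = 2^n is not a square
    (¬ IsSquareℕ (2 ^ n) →
      ∀ u → ¬ (u ≈ 0#) → cube u ≈ a →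
        (InAS (b * sq (inv u)) → Curve a b c ≅ E₁)
        × (¬ InAS (b * sq (inv u)) →
            (∃ λ v → 1# + v + pow4 v ≈ b * sq (inv u))
            × (∀ v → 1# + v + pow4 v ≈ b * sq (inv u) →
                 (Tr (c + cube v + v) ≈ 0# → Curve a b c ≅ H)
                 × (Tr (c + cube v + v) ≈ 1# → Curve a b c ≅ H′ c₀))))
proposition1p4 n F c₀ Tr[c₀]≈1 a b c a≉0 _ =
    (λ square →
        (λ hypothesis → L-solvable a≉0 hypothesis , E[a]-models)
      , (λ u u≉0 u³≈a → let m , n≡m+m = square⇒even-exponent square in EvenDegree.E₀-model m n≡m+m u≉0 u³≈a))
  , (λ ¬square u u≉0 u³≈a →
        OddDegree.E₁-model (nonSquare⇒Tr[1]≈1 ¬square) u≉0 u³≈a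
      , λ β∉AS → OddDegree.H-solvable (nonSquare⇒Tr[1]≈1 ¬square) β∉AS , λ _ → H-models u≉0 u³≈a)
  where
  open FieldDefs F
  open FiniteFieldTheory F
  open Classification c₀ Tr[c₀]≈1
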